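{- For all integers $n \geq 1$ and $k \geq 1$, the path $P_n$ on $n$ vertices satisfies $\gamma_{all,k}^\infty(P_n)=\lceil \frac{n}{k+1} \rceil$.
   Context: Graphs are finite and simple; $d(u,v)$ denotes graph distance, and $N_k[x]=\{v: d(x,v)\le k\}$. A multiset $D$ of vertices of $G$ is a distance-$k$ dominating set if every vertex of $V(G)\setminus D$ is at distance at most $k$ from some element of $D$. Let $\mathbb{D}_{k,q}(G)$ be the set of distance-$k$ dominating multisets of cardinality $q$. For $D=\{v_1,\dots,v_q\}$ and $D'=\{u_1,\dots,u_q\}$ in $\mathbb{D}_{k,q}(G)$, $D$ transforms to $D'$ if (for some indexing) $u_i\in N_k[v_i]$ for all $i$. An eternal distance-$k$ dominating family is a subset $\mathcal{E}\subseteq\mathbb{D}_{k,q}(G)$ for some $q$ such that for every $D\in\mathcal{E}$ and every vertex $v$ there is $D'\in\mathcal{E}$ with $v\in D'$ and $D$ transforms to $D'$. The eternal distance-$k$ domination number $\gamma_{all,k}^\infty(G)$ is the minimum $q$ for which an eternal distance-$k$ dominating family of $G$ (consisting of multisets of size $q$) exists. -}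

module Defs where

open import Data.Nat using (ℕ; zero; suc; _+_; _≤_)
open import Data.Nat.DivMod using (_/_)
open import Data.Fin using (Fin; toℕ)
open import Data.Fin.Permutation using (Permutation′; _⟨$⟩ʳ_)
open import Data.Product using (Σ; ∃; ∃-syntax; _×_; _,_)
open import Data.Sum using (_⊎_)
open import Relation.Binary.PropositionalEquality using (_≡_)
open import Relation.Nullary using (¬_)

record Graph (n : ℕ) : Set₁ where
  field
    Adj     : Fin n → Fin n → Set
    irrefl  : ∀ {u} → ¬ Adj u u
    sym     : ∀ {u v} → Adj u v → Adj v u

open Graph public

PathAdj : (n : ℕ) → Fin n → Fin n → Set
PathAdj n i j = (suc (toℕ i) ≡ toℕ j) ⊎ (suc (toℕ j) ≡ toℕ i)

-- Graph distance is at most k: there is a walk with at most k edges.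
data Within {n : ℕ} (G : Graph n) : ℕ → Fin n → Fin n → Set where
  here : ∀ {k v} → Within G k v v
  step : ∀ {k u w v} → Adj G u w → Within G k w v → Within G (suc k) u v

-- Multisets of q vertices are represented by q-tuples (Fin q → Fin n);
-- all notions below are invariant under reindexing.

Multiset : ℕ → ℕ → Set
Multiset n q = Fin q → Fin n

_∈ᴹ_ : {n q : ℕ} → Fin n → Multiset n q → Set
v ∈ᴹ D = ∃[ i ] D i ≡ v

IsDistDom : {n q : ℕ} → Graph n → ℕ → Multiset n q → Set
IsDistDom G k D = ∀ v → ¬ (v ∈ᴹ D) → ∃[ i ] Within G k (D i) v

Transforms : {n q : ℕ} → Graph n → ℕ → Multiset n q → Multiset n q → Set
Transforms {q = q} G k D D' =
  Σ (Permutation′ q) λ σ → ∀ i → Within G k (D i) (D' (σ ⟨$⟩ʳ i))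

record EternalFamily {n : ℕ} (G : Graph n) (k q : ℕ) : Set₁ where
  field
    E         : Multiset n q → Set
    nonempty  : ∃[ D ] E D
    dominating : ∀ D → E D → IsDistDom G k D
    respond   : ∀ D → E D → ∀ v →
                ∃[ D' ] (E D' × v ∈ᴹ D' × Transforms G k D D')

IsEternalDistDomNumber : {n : ℕ} → Graph n → ℕ → ℕ → Set₁
IsEternalDistDomNumber G k m =
  EternalFamily G k m × (∀ q → EternalFamily G k q → m ≤ q)

P : (n : ℕ) → Graph n
P n = record
  { Adj = PathAdj n
  ; irrefl = irr
  ; sym = sy
  }
  where
  open import Data.Sum using (inj₁; inj₂)
  open import Data.Nat.Properties using (1+n≢n)

  irr : ∀ {u} → ¬ PathAdj n u u
  irr (inj₁ e) = 1+n≢n e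
  irr (inj₂ e) = 1+n≢n e
  sy : ∀ {u v} → PathAdj n u v → PathAdj n v u
  sy (inj₁ e) = inj₂ e
  sy (inj₂ e) = inj₁ e

⌈_/suc_⌉ : ℕ → ℕ → ℕ
⌈ n /suc k ⌉ = (n + k) / suc k

{-# OPTIONS --safe #-}
module Submission where

open import Defs hiding (sym)
open import Data.Nat using (ℕ; _≤_; zero; suc; _+_; _*_; _<_; s≤s; s≤s⁻¹; _/_)
open import Data.Nat.Properties
open import Data.Nat.DivMod using (m≡m%n+[m/n]*n; m/n*n≤m; m%n<n; /-monoˡ-≤; +-distrib-/-∣ʳ; n/n≡1)
open import Data.Nat.Divisibility using (∣-refl)
open import Data.Fin as F using (Fin; toℕ; fromℕ<)
open import Data.Fin.Properties using (toℕ-injective; toℕ-fromℕ<; toℕ<n; injective⇒≤)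
open import Data.Fin.Permutation as Perm using (_⟨$⟩ʳ_)
open import Data.Vec.Functional using (Vector; _∷_; updateAt)
open import Data.Vec.Functional.Properties using (updateAt-updates; updateAt-minimal)
open import Data.Product using (Σ; ∃-syntax; _×_; _,_)
open import Data.Sum using (inj₁; inj₂)
open import Function using (const)
open import Function.Bundles using (Injection)
open import Function.Properties.Inverse using (↔⇒↣)
open import Function.Definitions using (Injective)
import Function.Construct.Composition as Comp
open import Relation.Binary.PropositionalEquality using (_≡_; refl; sym; trans; cong; subst; module ≡-Reasoning)
open import Relation.Nullary using (¬_; yes; no; contradiction)

-- Cut P_n into consecutive blocks of k + 1 vertices, the last one possibly
-- shorter; there are ⌈n/(k+1)⌉ of them and each has diameter at most k.  Keeping
-- one guard in every block is eternally dominating: an attack at v is answered by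
-- the guard of v's block alone.  Conversely, attack 0, k+1, 2(k+1), …, J(k+1)
-- in turn, where J = ⌈n/(k+1)⌉ - 1.  A guard that has answered one of the first
-- j attacks stands at most j(k+1) - 1 after the next move, so the attack at
-- j(k+1) is answered by a fresh guard, and J + 1 distinct guards are needed.

module _ {n : ℕ} (G : Graph n) where

  Within-mono : ∀ {k l u v} → k ≤ l → Within G k u v → Within G l u v
  Within-mono _         here         = here
  Within-mono (s≤s k≤l) (step uw wv) = step uw (Within-mono k≤l wv)

  Within-snoc : ∀ {k u w v} → Within G k u w → Adj G w v → Within G (suc k) u v
  Within-snoc here         wv = step wv here
  Within-snoc (step ux xw) wv = step ux (Within-snoc xw wv)

  Within-sym : ∀ {k u v} → Within G k u v → Within G k v u
  Within-sym here         = here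
  Within-sym (step uw wv) = Within-snoc (Within-sym wv) (Graph.sym G uw)

within-path-≤ : ∀ {n k} {a b : Fin n} → Within (P n) k a b → toℕ b ≤ toℕ a + k
within-path-≤ {k = k} {a} here = m≤m+n (toℕ a) k
within-path-≤ {k = suc k} {a} (step {w = w} aw wb) = begin
  toℕ _                  ≤⟨ within-path-≤ wb ⟩
  toℕ w + k              ≤⟨ +-monoˡ-≤ k (adjacent-≤ aw) ⟩
  suc (toℕ a) + k        ≡⟨ +-suc (toℕ a) k ⟨
  toℕ a + suc k          ∎
  where
  open ≤-Reasoning
  adjacent-≤ : PathAdj _ a w → toℕ w ≤ suc (toℕ a)
  adjacent-≤ (inj₁ a+1≡w) = ≤-reflexive (sym a+1≡w)
  adjacent-≤ (inj₂ w+1≡a) = ≤-trans (n≤1+n (toℕ w)) (≤-trans (≤-reflexive w+1≡a) (n≤1+n (toℕ a)))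

path-walk-up : ∀ {n} d (a b : Fin n) → toℕ b ≡ toℕ a + d → Within (P n) d a b
path-walk-up zero    a b b≡a+0 = subst (Within (P _) 0 a) (toℕ-injective (sym (trans b≡a+0 (+-identityʳ _)))) here
path-walk-up (suc d) a b b≡a+1+d = step (inj₁ (sym (toℕ-fromℕ< a+1<n))) (path-walk-up d a′ b b≡a′+d)
  where
  a+1<n : suc (toℕ a) < _
  a+1<n = ≤-<-trans (≤-trans (m≤m+n (suc (toℕ a)) d) (≤-reflexive (trans (sym (+-suc (toℕ a) d)) (sym b≡a+1+d)))) (toℕ<n b)
  a′ = fromℕ< a+1<n
  b≡a′+d : toℕ b ≡ toℕ a′ + d
  b≡a′+d = trans b≡a+1+d (trans (+-suc (toℕ a) d) (cong (_+ d) (sym (toℕ-fromℕ< a+1<n))))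

within-path : ∀ {n k} (a b : Fin n) → toℕ b ≤ toℕ a + k → toℕ a ≤ toℕ b + k → Within (P n) k a b
within-path a b b≤a+k a≤b+k with ≤-total (toℕ a) (toℕ b)
... | inj₁ a≤b = Within-mono (P _) (m≤n+o⇒m∸n≤o _ _ b≤a+k)
                   (path-walk-up _ a b (sym (m+[n∸m]≡n a≤b)))
... | inj₂ b≤a = Within-sym (P _) (Within-mono (P _) (m≤n+o⇒m∸n≤o _ _ a≤b+k)
                   (path-walk-up _ b a (sym (m+[n∸m]≡n b≤a))))

updateAt-preserves : ∀ {A : Set} {q} (R : Fin q → A → Set) (xs : Vector A q) i {f : A → A} →
                     (∀ j → R j (xs j)) → R i (f (xs i)) → ∀ j → R j (updateAt xs i f j)
updateAt-preserves R xs i Rxs Rfi j with j F.≟ i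
... | yes refl = subst (R i) (sym (updateAt-updates i xs)) Rfi
... | no j≢i   = subst (R j) (sym (updateAt-minimal j i xs j≢i)) (Rxs j)

∷-injective : ∀ {A : Set} {j} {x : A} {f : Vector A j} →
              Injective _≡_ _≡_ f → (∀ t → ¬ f t ≡ x) → Injective _≡_ _≡_ (x ∷ f)
∷-injective f-inj x∉f {F.zero}  {F.zero}  _   = refl
∷-injective f-inj x∉f {F.zero}  {F.suc u} x≡fu = contradiction (sym x≡fu) (x∉f u)
∷-injective f-inj x∉f {F.suc t} {F.zero}  ft≡x = contradiction ft≡x (x∉f t)
∷-injective f-inj x∉f {F.suc t} {F.suc u} ft≡fu = cong F.suc (f-inj ft≡fu)

⌈suc/suc⌉ : ∀ n k → ⌈ suc n /suc k ⌉ ≡ suc (n / suc k)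
⌈suc/suc⌉ n k = begin
  (suc n + k) / suc k        ≡⟨ cong (_/ suc k) (+-suc n k) ⟨
  (n + suc k) / suc k        ≡⟨ +-distrib-/-∣ʳ n ∣-refl ⟩
  n / suc k + suc k / suc k  ≡⟨ cong (n / suc k +_) (n/n≡1 (suc k)) ⟩
  n / suc k + 1              ≡⟨ +-comm (n / suc k) 1 ⟩
  suc (n / suc k)            ∎
  where open ≡-Reasoning

module Blocks (n′ k : ℕ) where
  N = suc n′
  m = suc k
  J = n′ / m
  q = suc J

  InBlock : Fin q → Fin N → Set
  InBlock i x = toℕ i * m ≤ toℕ x × toℕ x ≤ toℕ i * m + k

  InBlock-within : ∀ i {a b : Fin N} → InBlock i a → InBlock i b → Within (P N) k a b
  InBlock-within _ (la , ha) (lb , hb) =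
    within-path _ _ (≤-trans hb (+-monoˡ-≤ k la)) (≤-trans ha (+-monoˡ-≤ k lb))

  Jm<N : J * m < N
  Jm<N = s≤s (m/n*n≤m n′ m)

  blockStart : Fin q → Fin N
  blockStart i = fromℕ< (≤-<-trans (*-monoˡ-≤ m (s≤s⁻¹ (toℕ<n i))) Jm<N)

  blockStart-InBlock : ∀ i → InBlock i (blockStart i)
  blockStart-InBlock i rewrite toℕ-fromℕ< (≤-<-trans (*-monoˡ-≤ m (s≤s⁻¹ (toℕ<n i))) Jm<N) =
    ≤-refl , m≤m+n _ k

  blockOf : Fin N → Fin q
  blockOf v = fromℕ< (s≤s (/-monoˡ-≤ m (s≤s⁻¹ (toℕ<n v))))

  blockOf-InBlock : ∀ v → InBlock (blockOf v) v
  blockOf-InBlock v rewrite toℕ-fromℕ< (s≤s (/-monoˡ-≤ m (s≤s⁻¹ (toℕ<n v)))) =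
    subst (toℕ v / m * m ≤_) (sym v≡) (m≤n+m _ _) ,
    subst (_≤ toℕ v / m * m + k) (sym v≡)
      (≤-trans (+-monoˡ-≤ _ (s≤s⁻¹ (m%n<n (toℕ v) m))) (≤-reflexive (+-comm k _)))
    where v≡ = m≡m%n+[m/n]*n (toℕ v) m

  OneGuardPerBlock : Multiset N q → Set
  OneGuardPerBlock D = ∀ i → InBlock i (D i)

  guardFamily : EternalFamily (P N) k q
  guardFamily = record
    { E          = OneGuardPerBlock
    ; nonempty   = blockStart , blockStart-InBlock
    ; dominating = λ D D-ok v _ → blockOf v , InBlock-within (blockOf v) (D-ok (blockOf v)) (blockOf-InBlock v)
    ; respond    = λ D D-ok v →
        let i = blockOf v in
        updateAt D i (const v) ,
        updateAt-preserves InBlock D i D-ok (blockOf-InBlock v) ,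
        (i , updateAt-updates i D) ,
        Perm.id , updateAt-preserves (λ j → Within (P N) k (D j)) D i (λ _ → here)
                    (InBlock-within i (D-ok i) (blockOf-InBlock v))
    }

  module LowerBound {Q} (Fam : EternalFamily (P N) k Q) where
    open EternalFamily Fam

    DistinctGuardsUpTo : ℕ → Multiset N Q → Set
    DistinctGuardsUpTo j D =
      Σ (Fin (suc j) → Fin Q) λ f → Injective _≡_ _≡_ f × (∀ t → toℕ (D (f t)) ≤ j * m)

    distinctGuardsUpTo : ∀ j → j * m < N → ∃[ D ] E D × DistinctGuardsUpTo j D
    distinctGuardsUpTo zero 0<N with nonempty
    ... | D₀ , D₀∈E with respond D₀ D₀∈E (fromℕ< 0<N)
    ... | D , D∈E , (i , Di≡0) , _ =
      D , D∈E , const i , (λ { {F.zero} {F.zero} _ → refl }) ,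
      λ _ → ≤-reflexive (trans (cong toℕ Di≡0) (toℕ-fromℕ< 0<N))
    distinctGuardsUpTo (suc j) jm+m<N with distinctGuardsUpTo j (≤-<-trans (m≤n+m (j * m) m) jm+m<N)
    ... | D , D∈E , f , f-inj , f-below with respond D D∈E (fromℕ< jm+m<N)
    ... | D′ , D′∈E , (i , D′i≡attack) , (σ , moves) =
      D′ , D′∈E , i ∷ g , ∷-injective g-inj g≢i ,
      λ { F.zero → ≤-reflexive D′i≡jm+m ; (F.suc t) → <⇒≤ (g-below t) }
      where
      g : Fin (suc j) → Fin Q
      g t = σ ⟨$⟩ʳ f t
      g-inj : Injective _≡_ _≡_ g
      g-inj = Comp.injective _≡_ _≡_ _≡_ f-inj (Injection.injective (↔⇒↣ σ))
      D′i≡jm+m : toℕ (D′ i) ≡ m + j * m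
      D′i≡jm+m = trans (cong toℕ D′i≡attack) (toℕ-fromℕ< jm+m<N)
      g-below : ∀ t → toℕ (D′ (g t)) < m + j * m
      g-below t = begin-strict
        toℕ (D′ (g t))     ≤⟨ within-path-≤ (moves (f t)) ⟩
        toℕ (D (f t)) + k  ≤⟨ +-monoˡ-≤ k (f-below t) ⟩
        j * m + k          <⟨ +-monoʳ-< (j * m) (n<1+n k) ⟩
        j * m + m          ≡⟨ +-comm (j * m) m ⟩
        m + j * m          ∎
        where open ≤-Reasoning
      g≢i : ∀ t → ¬ g t ≡ i
      g≢i t refl = <-irrefl D′i≡jm+m (g-below t)

    guards-≥ : q ≤ Q
    guards-≥ with distinctGuardsUpTo J Jm<N
    ... | _ , _ , _ , f-inj , _ = injective⇒≤ f-inj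

theorem2 : (n k : ℕ) → 1 ≤ n → 1 ≤ k →
    IsEternalDistDomNumber (P n) k ⌈ n /suc k ⌉
theorem2 (suc n′) k _ _ rewrite ⌈suc/suc⌉ n′ k =
  guardFamily , λ Q Fam → LowerBound.guards-≥ Fam
  where open Blocks n′ k
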